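{- Let $D$ and $\mu_{D,n}$ be as in the context. Then the sequence $\big(\mu_{D,n}([0,1/2))\big)_{n\geqslant 0}$ does not converge. Moreover, it is not eventually periodic.
   Context: Let ${\bf B}_0=\begin{pmatrix}1&0\\0&1\end{pmatrix}$ and ${\bf B}_1=\begin{pmatrix}3&-3\\3&3\end{pmatrix}$, and for $m\geqslant 0$ let $D(m)=e_1^T{\bf B}_1^{s_2(m)}e_1$, where $s_2(m)$ is the sum of the binary digits of $m$ and $e_1=(1,0)^T$ (equivalently $D(m)=e_1^T{\bf B}_{i_0}\cdots{\bf B}_{i_s}e_1$ with $i_s\cdots i_0$ the binary expansion of $m$). Let $\varSigma_D(n)=\sum_{m=2^n}^{2^{n+1}-1}D(m)$ and $\mu_{D,n}=\frac{1}{\varSigma_D(n)}\sum_{m=2^n}^{2^{n+1}-1}D(m)\,\delta_{(m-2^n)/2^n}$, a (signed) pure point measure on $\mathbb{T}=[0,1)$, where $\delta_x$ is the unit Dirac measure at $x$. -}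

module Defs where

open import Data.Nat as ℕ using (ℕ; zero; suc; _^_; _∸_)
open import Data.Nat.DivMod using (_%_; _/_)
open import Data.Nat.Properties using (m^n≢0)
open import Data.Integer as ℤ using (ℤ; +_; -[1+_])
open import Data.Rational as ℚ using (ℚ; 0ℚ; ∣_∣)
open import Data.Rational.Properties using (_<?_)
open import Data.Product using (Σ; _×_; ∃; _,_)
open import Relation.Nullary using (yes; no; ¬_)
open import Relation.Binary.PropositionalEquality using (_≡_)

record Mat2 : Set where
  constructor mat
  field
    a11 a12 a21 a22 : ℤ
open Mat2 public

_⊗_ : Mat2 → Mat2 → Mat2
mat a b c d ⊗ mat e f g h =
  mat (a ℤ.* e ℤ.+ b ℤ.* g) (a ℤ.* f ℤ.+ b ℤ.* h)
      (c ℤ.* e ℤ.+ d ℤ.* g) (c ℤ.* f ℤ.+ d ℤ.* h)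

B₀ : Mat2
B₀ = mat (+ 1) (+ 0) (+ 0) (+ 1)

B₁ : Mat2
B₁ = mat (+ 3) (ℤ.- (+ 3)) (+ 3) (+ 3)

_^ᴹ_ : Mat2 → ℕ → Mat2
M ^ᴹ zero  = B₀
M ^ᴹ suc k = M ⊗ (M ^ᴹ k)

-- sum of binary digits; the fuel m is always ≥ the number of binary digits of m
s₂-go : ℕ → ℕ → ℕ
s₂-go zero    m = 0
s₂-go (suc f) m = m % 2 ℕ.+ s₂-go f (m / 2)

s₂ : ℕ → ℕ
s₂ m = s₂-go m m

D : ℕ → ℤ
D m = a11 (B₁ ^ᴹ s₂ m)

sumFrom : ℕ → ℕ → (ℕ → ℤ) → ℤ
sumFrom a zero    f = + 0
sumFrom a (suc k) f = f a ℤ.+ sumFrom (suc a) k f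

Σ-D : ℕ → ℤ
Σ-D n = sumFrom (2 ^ n) (2 ^ n) D

-- total division of an integer by an integer (only used with nonzero denominators;
-- returns 0 for a zero denominator, a case that never occurs for Σ-D)
_÷ℤ_ : ℤ → ℤ → ℚ
p ÷ℤ (+ zero)    = 0ℚ
p ÷ℤ (+ (suc k)) = p ℚ./ suc k
p ÷ℤ -[1+ k ]    = (ℤ.- p) ℚ./ suc k

atom : ℕ → ℕ → ℚ
atom n m = (+ (m ∸ 2 ^ n)) ℚ./ (2 ^ n)
  where instance _ = m^n≢0 2 n

half : ℚ
half = + 1 ℚ./ 2

weightHalf : ℕ → ℕ → ℤ
weightHalf n m with atom n m <? half
... | yes _ = D m
... | no  _ = + 0

μ-half : ℕ → ℚ
μ-half n = sumFrom (2 ^ n) (2 ^ n) (weightHalf n) ÷ℤ Σ-D n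

-- convergence of a rational sequence (in ℝ), via the Cauchy criterion
Converges : (ℕ → ℚ) → Set
Converges x = ∀ (ε : ℚ) → 0ℚ ℚ.< ε →
  ∃ λ N → ∀ m n → N ℕ.≤ m → N ℕ.≤ n → ∣ x m ℚ.- x n ∣ ℚ.< ε

EventuallyPeriodic : (ℕ → ℚ) → Set
EventuallyPeriodic x =
  ∃ λ N → ∃ λ p → (0 ℕ.< p) × (∀ n → N ℕ.≤ n → x (n ℕ.+ p) ≡ x n)

-- The total mass Σ_D(n) of block n is Σ_{i<2ⁿ} f(1 + s₂(i)) for f(k) = (B₁ᵏ)₁₁, since
-- s₂(2ⁿ + i) = 1 + s₂(i).  Splitting a block by its top binary digit is the binomial
-- transform, so f(k+2) = 6 f(k+1) − 18 f(k) (Cayley–Hamilton for B₁) turns into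
-- Σ_D(n+2) = 8 Σ_D(n+1) − 25 Σ_D(n), with Σ_D(0) = Σ_D(1) = 3.  The lower half of block
-- n+1 is a copy of block n, so μ_{D,n+1}([0,1/2)) = Σ_D(n)/Σ_D(n+1) =: r(n).
-- For consecutive terms a, b, c of the recurrence, r(n+1) − r(n) = (b² − ac)/(bc), and
-- positive definiteness of b² − 8ab + 25a² gives |bc| ≤ 25 |b² − ac|: consecutive ratios
-- stay 1/25 apart.  If r(n+p) = r(n), the Casoratian Σ_D(n+p)Σ_D(n+1) − Σ_D(n)Σ_D(n+1+p)
-- vanishes; it is multiplied by 25 at each step, so it vanishes at n = 0, forcing
-- Σ_D(p) = Σ_D(p+1), which is impossible because no Σ_D(n) is divisible by 5.

module Submission where

open import Defs
open import Data.Product using (_×_; _,_)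
open import Relation.Nullary using (¬_; yes; no)

open import Data.Empty using (⊥-elim)
open import Function.Base using (_∘_)
open import Function.Bundles using (_⇔_; mk⇔; Equivalence)
open import Relation.Nullary.Decidable using (from-no)
open import Relation.Binary.PropositionalEquality
open import Data.Nat as ℕ using (ℕ; zero; suc; _^_; z≤n; s≤s)
import Data.Nat.Properties as ℕP
open import Data.Nat.DivMod
  using (_%_; _/_; m/n<m; [m+kn]%n≡m%n; m<n*o⇒m/o<n; +-distrib-/-∣ʳ; m*n/n≡m)
open import Data.Nat.Divisibility using (n∣m*n)
import Data.Nat.Tactic.RingSolver as ℕ-Solver
open import Data.Integer as ℤ using (ℤ; +_; -[1+_])
import Data.Integer.Properties as ℤP
open import Data.Integer.Divisibility.Signed using (_∣_; _∣?_; divides; ∣-refl; ∣m∣n⇒∣m+n; ∣n⇒∣m*n)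
open import Data.Integer.Tactic.RingSolver using (solve-∀)
open import Data.Rational as ℚ using (ℚ; ↥_; ↧_)
import Data.Rational.Properties as ℚP
open import Data.Rational.Properties using (_<?_)
import Data.Rational.Unnormalised as ℚᵘ
import Data.Rational.Unnormalised.Properties as ℚᵘP

open ≡-Reasoning

-- Binary digit sums

s₂-go-zero : ∀ f → s₂-go f 0 ≡ 0
s₂-go-zero zero    = refl
s₂-go-zero (suc f) = s₂-go-zero f

m≤1+f⇒m/2≤f : ∀ m f → m ℕ.≤ suc f → m / 2 ℕ.≤ f
m≤1+f⇒m/2≤f zero    f _          = z≤n
m≤1+f⇒m/2≤f (suc m) f (s≤s m≤f) = ℕP.≤-trans (ℕP.≤-pred (m/n<m (suc m) 2 (s≤s (s≤s z≤n)))) m≤f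

s₂-go-fuel-irrelevant : ∀ f g m → m ℕ.≤ f → m ℕ.≤ g → s₂-go f m ≡ s₂-go g m
s₂-go-fuel-irrelevant zero    g       _ z≤n _   = sym (s₂-go-zero g)
s₂-go-fuel-irrelevant (suc f) zero    _ _   z≤n = s₂-go-zero (suc f)
s₂-go-fuel-irrelevant (suc f) (suc g) m m≤f m≤g =
  cong (m % 2 ℕ.+_) (s₂-go-fuel-irrelevant f g (m / 2) (m≤1+f⇒m/2≤f m f m≤f) (m≤1+f⇒m/2≤f m g m≤g))

s₂-step : ∀ m → s₂ m ≡ m % 2 ℕ.+ s₂ (m / 2)
s₂-step zero    = refl
s₂-step (suc m) = cong (suc m % 2 ℕ.+_)
  (s₂-go-fuel-irrelevant m (suc m / 2) (suc m / 2) (m≤1+f⇒m/2≤f (suc m) m ℕP.≤-refl) ℕP.≤-refl)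

s₂-2^n+ : ∀ n i → i ℕ.< 2 ^ n → s₂ (2 ^ n ℕ.+ i) ≡ suc (s₂ i)
s₂-2^n+ zero    zero    _            = refl
s₂-2^n+ zero    (suc i) (s≤s ())
s₂-2^n+ (suc n) i i<2^[1+n] = begin
  s₂ (2 ^ suc n ℕ.+ i)
    ≡⟨ cong s₂ (trans (ℕP.+-comm (2 ^ suc n) i) (cong (i ℕ.+_) (ℕP.*-comm 2 (2 ^ n)))) ⟩
  s₂ (i ℕ.+ 2 ^ n ℕ.* 2)                ≡⟨ s₂-step (i ℕ.+ 2 ^ n ℕ.* 2) ⟩
  (i ℕ.+ 2 ^ n ℕ.* 2) % 2 ℕ.+ s₂ ((i ℕ.+ 2 ^ n ℕ.* 2) / 2)
    ≡⟨ cong₂ (λ r q → r ℕ.+ s₂ q) ([m+kn]%n≡m%n i (2 ^ n) 2) i+2^[1+n]/2 ⟩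
  i % 2 ℕ.+ s₂ (2 ^ n ℕ.+ i / 2)        ≡⟨ cong (i % 2 ℕ.+_) (s₂-2^n+ n (i / 2) i/2<2^n) ⟩
  i % 2 ℕ.+ suc (s₂ (i / 2))            ≡⟨ ℕP.+-suc (i % 2) (s₂ (i / 2)) ⟩
  suc (i % 2 ℕ.+ s₂ (i / 2))            ≡⟨ cong suc (s₂-step i) ⟨
  suc (s₂ i)                            ∎
  where
  i/2<2^n : i / 2 ℕ.< 2 ^ n
  i/2<2^n = m<n*o⇒m/o<n (subst (i ℕ.<_) (ℕP.*-comm 2 (2 ^ n)) i<2^[1+n])
  i+2^[1+n]/2 : (i ℕ.+ 2 ^ n ℕ.* 2) / 2 ≡ 2 ^ n ℕ.+ i / 2
  i+2^[1+n]/2 = begin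
    (i ℕ.+ 2 ^ n ℕ.* 2) / 2       ≡⟨ +-distrib-/-∣ʳ i (n∣m*n (2 ^ n)) ⟩
    i / 2 ℕ.+ 2 ^ n ℕ.* 2 / 2     ≡⟨ cong (i / 2 ℕ.+_) (m*n/n≡m (2 ^ n) 2) ⟩
    i / 2 ℕ.+ 2 ^ n               ≡⟨ ℕP.+-comm (i / 2) (2 ^ n) ⟩
    2 ^ n ℕ.+ i / 2               ∎

sumFrom-shift : ∀ a b k (f : ℕ → ℤ) →
                sumFrom (a ℕ.+ b) k f ≡ sumFrom b k (λ i → f (a ℕ.+ i))
sumFrom-shift a b zero    f = refl
sumFrom-shift a b (suc k) f = cong (ℤ._+_ (f (a ℕ.+ b))) (begin
  sumFrom (suc (a ℕ.+ b)) k f    ≡⟨ cong (λ c → sumFrom c k f) (ℕP.+-suc a b) ⟨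
  sumFrom (a ℕ.+ suc b) k f      ≡⟨ sumFrom-shift a (suc b) k f ⟩
  sumFrom (suc b) k (λ i → f (a ℕ.+ i)) ∎)

sumFrom-from-0 : ∀ a k (f : ℕ → ℤ) → sumFrom a k f ≡ sumFrom 0 k (λ i → f (a ℕ.+ i))
sumFrom-from-0 a k f =
  trans (cong (λ c → sumFrom c k f) (sym (ℕP.+-identityʳ a))) (sumFrom-shift a 0 k f)

sumFrom-cong : ∀ a k {f g : ℕ → ℤ} →
               (∀ i → a ℕ.≤ i → i ℕ.< a ℕ.+ k → f i ≡ g i) → sumFrom a k f ≡ sumFrom a k g
sumFrom-cong a zero    f≡g = refl
sumFrom-cong a (suc k) f≡g = cong₂ ℤ._+_
  (f≡g a ℕP.≤-refl (ℕP.m<m+n a (s≤s z≤n)))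
  (sumFrom-cong (suc a) k λ i a<i i<a+1+k →
    f≡g i (ℕP.<⇒≤ a<i) (subst (i ℕ.<_) (sym (ℕP.+-suc a k)) i<a+1+k))

sumFrom-split : ∀ a k l (f : ℕ → ℤ) →
                sumFrom a (k ℕ.+ l) f ≡ sumFrom a k f ℤ.+ sumFrom (a ℕ.+ k) l f
sumFrom-split a zero    l f =
  trans (cong (λ c → sumFrom c l f) (sym (ℕP.+-identityʳ a))) (sym (ℤP.+-identityˡ _))
sumFrom-split a (suc k) l f = begin
  f a ℤ.+ sumFrom (suc a) (k ℕ.+ l) f
    ≡⟨ cong (ℤ._+_ (f a)) (sumFrom-split (suc a) k l f) ⟩
  f a ℤ.+ (sumFrom (suc a) k f ℤ.+ sumFrom (suc a ℕ.+ k) l f)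
    ≡⟨ ℤP.+-assoc (f a) _ _ ⟨
  f a ℤ.+ sumFrom (suc a) k f ℤ.+ sumFrom (suc a ℕ.+ k) l f
    ≡⟨ cong (λ c → f a ℤ.+ sumFrom (suc a) k f ℤ.+ sumFrom c l f) (ℕP.+-suc a k) ⟨
  f a ℤ.+ sumFrom (suc a) k f ℤ.+ sumFrom (a ℕ.+ suc k) l f ∎

sumFrom-0 : ∀ a k → sumFrom a k (λ _ → + 0) ≡ + 0
sumFrom-0 a zero    = refl
sumFrom-0 a (suc k) = trans (ℤP.+-identityˡ _) (sumFrom-0 (suc a) k)

-- Linear recurrences and the binomial transform

record LinRec (t d : ℤ) (x : ℕ → ℤ) : Set where
  constructor linRec
  field
    step : ∀ n → x (suc (suc n)) ≡ t ℤ.* x (suc n) ℤ.- d ℤ.* x n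
open LinRec public

linRec-resp : ∀ {t d} {x y : ℕ → ℤ} → (∀ n → x n ≡ y n) → LinRec t d x → LinRec t d y
linRec-resp {t} {d} {x} {y} x≡y rec = linRec λ n → begin
  y (suc (suc n))                          ≡⟨ x≡y (suc (suc n)) ⟨
  x (suc (suc n))                          ≡⟨ step rec n ⟩
  t ℤ.* x (suc n) ℤ.- d ℤ.* x n
    ≡⟨ cong₂ (λ u v → t ℤ.* u ℤ.- d ℤ.* v) (x≡y (suc n)) (x≡y n) ⟩
  t ℤ.* y (suc n) ℤ.- d ℤ.* y n           ∎

trace det : Mat2 → ℤ
trace M = a11 M ℤ.+ a22 M
det   M = a11 M ℤ.* a22 M ℤ.- a12 M ℤ.* a21 M

-- Cayley–Hamilton: M² = (trace M) M − (det M) I.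
a11-^ᴹ-linRec : ∀ M → LinRec (trace M) (det M) (λ k → a11 (M ^ᴹ k))
a11-^ᴹ-linRec M@(mat a b c d) = linRec λ n → cayleyHamilton a b c d (a11 (M ^ᴹ n)) (a21 (M ^ᴹ n))
  where
  cayleyHamilton : ∀ a b c d p r →
    a ℤ.* (a ℤ.* p ℤ.+ b ℤ.* r) ℤ.+ b ℤ.* (c ℤ.* p ℤ.+ d ℤ.* r)
      ≡ (a ℤ.+ d) ℤ.* (a ℤ.* p ℤ.+ b ℤ.* r) ℤ.- (a ℤ.* d ℤ.- b ℤ.* c) ℤ.* p
  cayleyHamilton = solve-∀

linRec-+shift : ∀ {t d} {x : ℕ → ℤ} → LinRec t d x → LinRec t d (λ n → x n ℤ.+ x (suc n))
linRec-+shift {t} {d} {x} rec = linRec λ n → begin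
  x (2 ℕ.+ n) ℤ.+ x (3 ℕ.+ n)
    ≡⟨ cong₂ ℤ._+_ (step rec n) (step rec (suc n)) ⟩
  (t ℤ.* x (1 ℕ.+ n) ℤ.- d ℤ.* x n) ℤ.+ (t ℤ.* x (2 ℕ.+ n) ℤ.- d ℤ.* x (1 ℕ.+ n))
    ≡⟨ distrib t d (x n) (x (1 ℕ.+ n)) (x (2 ℕ.+ n)) ⟩
  t ℤ.* (x (1 ℕ.+ n) ℤ.+ x (2 ℕ.+ n)) ℤ.- d ℤ.* (x n ℤ.+ x (1 ℕ.+ n)) ∎
  where
  distrib : ∀ t d u v w → (t ℤ.* v ℤ.- d ℤ.* u) ℤ.+ (t ℤ.* w ℤ.- d ℤ.* v)
                        ≡ t ℤ.* (v ℤ.+ w) ℤ.- d ℤ.* (u ℤ.+ v)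
  distrib = solve-∀

-- If y (1+n) = (1 + E) (y n) for the shift E, then y n = (1 + E)ⁿ (y 0), and since
-- (1+E)² − (t+2)(1+E) + (1+t+d) = E² − tE + d, the recurrence carries over to n.
module BinomialTransform (y : ℕ → ℕ → ℤ) (y-suc : ∀ n c → y (suc n) c ≡ y n c ℤ.+ y n (suc c))
                         {t d : ℤ} (rec₀ : LinRec t d (y 0)) where

  linRec-columns : ∀ n → LinRec t d (y n)
  linRec-columns zero    = rec₀
  linRec-columns (suc n) = linRec-resp (λ c → sym (y-suc n c)) (linRec-+shift (linRec-columns n))

  linRec-rows : ∀ c → LinRec (t ℤ.+ + 2) (+ 1 ℤ.+ t ℤ.+ d) (λ n → y n c)
  linRec-rows c = linRec λ n → let u₀ = y n c; u₁ = y n (suc c) in begin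
    y (2 ℕ.+ n) c
      ≡⟨ y-suc (suc n) c ⟩
    y (1 ℕ.+ n) c ℤ.+ y (1 ℕ.+ n) (1 ℕ.+ c)
      ≡⟨ cong₂ ℤ._+_ (y-suc n c) (y-suc n (suc c)) ⟩
    (u₀ ℤ.+ u₁) ℤ.+ (u₁ ℤ.+ y n (2 ℕ.+ c))
      ≡⟨ cong (λ u₂ → (u₀ ℤ.+ u₁) ℤ.+ (u₁ ℤ.+ u₂)) (step (linRec-columns n) c) ⟩
    (u₀ ℤ.+ u₁) ℤ.+ (u₁ ℤ.+ (t ℤ.* u₁ ℤ.- d ℤ.* u₀))
      ≡⟨ shifted t d u₀ u₁ ⟩
    (t ℤ.+ + 2) ℤ.* (u₀ ℤ.+ u₁) ℤ.- (+ 1 ℤ.+ t ℤ.+ d) ℤ.* u₀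
      ≡⟨ cong (λ v → (t ℤ.+ + 2) ℤ.* v ℤ.- (+ 1 ℤ.+ t ℤ.+ d) ℤ.* u₀) (y-suc n c) ⟨
    (t ℤ.+ + 2) ℤ.* y (1 ℕ.+ n) c ℤ.- (+ 1 ℤ.+ t ℤ.+ d) ℤ.* y n c ∎
    where
    shifted : ∀ t d u₀ u₁ → (u₀ ℤ.+ u₁) ℤ.+ (u₁ ℤ.+ (t ℤ.* u₁ ℤ.- d ℤ.* u₀))
                          ≡ (t ℤ.+ + 2) ℤ.* (u₀ ℤ.+ u₁) ℤ.- (+ 1 ℤ.+ t ℤ.+ d) ℤ.* u₀
    shifted = solve-∀

binarySum : (ℕ → ℤ) → ℕ → ℕ → ℤ
binarySum f n c = sumFrom 0 (2 ^ n) (λ i → f (c ℕ.+ s₂ i))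

binarySum-zero : ∀ f c → binarySum f 0 c ≡ f c
binarySum-zero f c = trans (ℤP.+-identityʳ _) (cong f (ℕP.+-identityʳ c))

binarySum-suc : ∀ f n c → binarySum f (suc n) c ≡ binarySum f n c ℤ.+ binarySum f n (suc c)
binarySum-suc f n c = begin
  sumFrom 0 (2 ^ n ℕ.+ (2 ^ n ℕ.+ 0)) g
    ≡⟨ cong (λ k → sumFrom 0 (2 ^ n ℕ.+ k) g) (ℕP.+-identityʳ (2 ^ n)) ⟩
  sumFrom 0 (2 ^ n ℕ.+ 2 ^ n) g
    ≡⟨ sumFrom-split 0 (2 ^ n) (2 ^ n) g ⟩
  binarySum f n c ℤ.+ sumFrom (2 ^ n) (2 ^ n) g
    ≡⟨ cong (ℤ._+_ (binarySum f n c)) (sumFrom-from-0 (2 ^ n) (2 ^ n) g) ⟩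
  binarySum f n c ℤ.+ sumFrom 0 (2 ^ n) (λ i → g (2 ^ n ℕ.+ i))
    ≡⟨ cong (ℤ._+_ (binarySum f n c)) (sumFrom-cong 0 (2 ^ n) upper) ⟩
  binarySum f n c ℤ.+ binarySum f n (suc c) ∎
  where
  g = λ i → f (c ℕ.+ s₂ i)
  upper : ∀ i → 0 ℕ.≤ i → i ℕ.< 2 ^ n → g (2 ^ n ℕ.+ i) ≡ f (suc c ℕ.+ s₂ i)
  upper i _ i<2^n = cong f (trans (cong (c ℕ.+_) (s₂-2^n+ n i i<2^n)) (ℕP.+-suc c (s₂ i)))

binarySum-linRec : ∀ {t d} {f : ℕ → ℤ} → LinRec t d f →
                   ∀ c → LinRec (t ℤ.+ + 2) (+ 1 ℤ.+ t ℤ.+ d) (λ n → binarySum f n c)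
binarySum-linRec {f = f} rec = linRec-rows
  where open BinomialTransform (binarySum f) (binarySum-suc f)
                               (linRec-resp (λ c → sym (binarySum-zero f c)) rec)

-- r ≈ p ÷ q says r = p/q by cross-multiplication, so that q may be negative.
infix 4 _≈_÷_

record _≈_÷_ (r : ℚ) (p q : ℤ) : Set where
  constructor mk≈
  field
    cross : ↥ r ℤ.* q ≡ p ℤ.* ↧ r
open _≈_÷_ public

/-≈ : ∀ p k → (p ℚ./ suc k) ≈ p ÷ + suc k
/-≈ p k with ℚP.toℚᵘ-fromℚᵘ (ℚᵘ.mkℚᵘ p k)
... | ℚᵘ.*≡* eq = mk≈ (begin
  ↥ r ℤ.* + suc k                ≡⟨ cong (ℤ._* + suc k) (ℚP.↥ᵘ-toℚᵘ r) ⟨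
  ℚᵘ.↥ ℚ.toℚᵘ r ℤ.* + suc k      ≡⟨ eq ⟩
  p ℤ.* ℚᵘ.↧ ℚ.toℚᵘ r            ≡⟨ cong (p ℤ.*_) (ℚP.↧ᵘ-toℚᵘ r) ⟩
  p ℤ.* ↧ r                      ∎)
  where
  r = p ℚ./ suc k

÷ℤ-≈ : ∀ p q .{{_ : ℤ.NonZero q}} → (p ÷ℤ q) ≈ p ÷ q
÷ℤ-≈ p (+ zero)  = ⊥-elim (ℕ.≢-nonZero⁻¹ 0 refl)
÷ℤ-≈ p (+ suc k) = /-≈ p k
÷ℤ-≈ p -[1+ k ]  = mk≈ (begin
  ↥ r ℤ.* ℤ.- + suc k      ≡⟨ ℤP.neg-distribʳ-* (↥ r) (+ suc k) ⟨
  ℤ.- (↥ r ℤ.* + suc k)    ≡⟨ cong ℤ.-_ (cross (/-≈ (ℤ.- p) k)) ⟩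
  ℤ.- (ℤ.- p ℤ.* ↧ r)      ≡⟨ cong ℤ.-_ (ℤP.neg-distribˡ-* p (↧ r)) ⟨
  ℤ.- ℤ.- (p ℤ.* ↧ r)      ≡⟨ ℤP.neg-involutive (p ℤ.* ↧ r) ⟩
  p ℤ.* ↧ r                ∎)
  where
  r = (ℤ.- p) ℚ./ suc k

≈-unique : ∀ {r p q p′ q′} → r ≈ p ÷ q → r ≈ p′ ÷ q′ → p ℤ.* q′ ≡ p′ ℤ.* q
≈-unique {r} {p} {q} {p′} {q′} (mk≈ r≈p/q) (mk≈ r≈p′/q′) = ℤP.*-cancelʳ-≡ _ _ (↧ r) (begin
  p ℤ.* q′ ℤ.* ↧ r      ≡⟨ swap p q′ (↧ r) ⟩
  p ℤ.* ↧ r ℤ.* q′      ≡⟨ cong (ℤ._* q′) r≈p/q ⟨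
  ↥ r ℤ.* q ℤ.* q′      ≡⟨ swap (↥ r) q q′ ⟩
  ↥ r ℤ.* q′ ℤ.* q      ≡⟨ cong (ℤ._* q) r≈p′/q′ ⟩
  p′ ℤ.* ↧ r ℤ.* q      ≡⟨ swap p′ (↧ r) q ⟩
  p′ ℤ.* q ℤ.* ↧ r      ∎)
  where
  swap : ∀ a b c → a ℤ.* b ℤ.* c ≡ a ℤ.* c ℤ.* b
  swap = solve-∀

≈-rescale : ∀ {r P Q p q} .{{_ : ℤ.NonZero Q}} → r ≈ P ÷ Q → P ℤ.* q ≡ p ℤ.* Q → r ≈ p ÷ q
≈-rescale {r} {P} {Q} {p} {q} (mk≈ r≈P/Q) Pq≡pQ =
  mk≈ (ℤP.*-cancelʳ-≡ _ _ Q (begin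
  ↥ r ℤ.* q ℤ.* Q       ≡⟨ swap (↥ r) q Q ⟩
  ↥ r ℤ.* Q ℤ.* q       ≡⟨ cong (ℤ._* q) r≈P/Q ⟩
  P ℤ.* ↧ r ℤ.* q       ≡⟨ swap P (↧ r) q ⟩
  P ℤ.* q ℤ.* ↧ r       ≡⟨ cong (ℤ._* ↧ r) Pq≡pQ ⟩
  p ℤ.* Q ℤ.* ↧ r       ≡⟨ swap p Q (↧ r) ⟩
  p ℤ.* ↧ r ℤ.* Q       ∎))
  where
  swap : ∀ a b c → a ℤ.* b ℤ.* c ≡ a ℤ.* c ℤ.* b
  swap = solve-∀

-‿≈-canonical : ∀ x y → (x ℚ.- y) ≈ ↥ x ℤ.* ↧ y ℤ.- ↥ y ℤ.* ↧ x ÷ ↧ x ℤ.* ↧ y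
-‿≈-canonical x@(ℚ.mkℚ _ _ _) y@(ℚ.mkℚ ny _ _)
  with ℚᵘP.≃-trans (ℚP.toℚᵘ-homo-+ x (ℚ.- y)) (ℚᵘP.+-congʳ (ℚ.toℚᵘ x) (ℚP.toℚᵘ-homo‿- y))
... | ℚᵘ.*≡* eq = mk≈ (begin
  ↥ d ℤ.* (↧ x ℤ.* ↧ y)                              ≡⟨ cong (ℤ._* (↧ x ℤ.* ↧ y)) (ℚP.↥ᵘ-toℚᵘ d) ⟨
  ℚᵘ.↥ ℚ.toℚᵘ d ℤ.* (↧ x ℤ.* ↧ y)                    ≡⟨ eq ⟩
  (↥ x ℤ.* ↧ y ℤ.+ ℤ.- ny ℤ.* ↧ x) ℤ.* ℚᵘ.↧ ℚ.toℚᵘ d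
    ≡⟨ cong₂ (λ u v → (↥ x ℤ.* ↧ y ℤ.+ u) ℤ.* v) (sym (ℤP.neg-distribˡ-* ny (↧ x))) (ℚP.↧ᵘ-toℚᵘ d) ⟩
  (↥ x ℤ.* ↧ y ℤ.- ny ℤ.* ↧ x) ℤ.* ↧ d               ∎)
  where
  d = x ℚ.- y

-‿≈ : ∀ {x y p q p′ q′} → x ≈ p ÷ q → y ≈ p′ ÷ q′ →
      (x ℚ.- y) ≈ p ℤ.* q′ ℤ.- p′ ℤ.* q ÷ q ℤ.* q′
-‿≈ {x} {y} {p} {q} {p′} {q′} (mk≈ x≈p/q) (mk≈ y≈p′/q′) =
  ≈-rescale {{ℤP.i*j≢0 (↧ x) (↧ y)}} (-‿≈-canonical x y) (begin
  (↥ x ℤ.* ↧ y ℤ.- ↥ y ℤ.* ↧ x) ℤ.* (q ℤ.* q′)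
    ≡⟨ regroup (↥ x) (↥ y) (↧ x) (↧ y) q q′ ⟩
  ↥ x ℤ.* q ℤ.* (↧ y ℤ.* q′) ℤ.- ↥ y ℤ.* q′ ℤ.* (↧ x ℤ.* q)
    ≡⟨ cong₂ (λ u v → u ℤ.* (↧ y ℤ.* q′) ℤ.- v ℤ.* (↧ x ℤ.* q)) x≈p/q y≈p′/q′ ⟩
  p ℤ.* ↧ x ℤ.* (↧ y ℤ.* q′) ℤ.- p′ ℤ.* ↧ y ℤ.* (↧ x ℤ.* q)
    ≡⟨ factor p p′ (↧ x) (↧ y) q q′ ⟩
  (p ℤ.* q′ ℤ.- p′ ℤ.* q) ℤ.* (↧ x ℤ.* ↧ y) ∎)
  where
  regroup : ∀ a b c d q q′ → (a ℤ.* d ℤ.- b ℤ.* c) ℤ.* (q ℤ.* q′)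
                           ≡ a ℤ.* q ℤ.* (d ℤ.* q′) ℤ.- b ℤ.* q′ ℤ.* (c ℤ.* q)
  regroup = solve-∀
  factor : ∀ p p′ c d q q′ → p ℤ.* c ℤ.* (d ℤ.* q′) ℤ.- p′ ℤ.* d ℤ.* (c ℤ.* q)
                           ≡ (p ℤ.* q′ ℤ.- p′ ℤ.* q) ℤ.* (c ℤ.* d)
  factor = solve-∀

∣∣<1/25⇒ : ∀ r → ℚ.∣ r ∣ ℚ.< + 1 ℚ./ 25 → ℤ.∣ ↥ r ∣ ℕ.* 25 ℕ.< ℤ.∣ ↧ r ∣
∣∣<1/25⇒ (ℚ.mkℚ n _ _) (ℚ.*<* lt) =
  ℤP.drop‿+<+ (subst₂ ℤ._<_ (sym (ℤP.pos-* ℤ.∣ n ∣ 25)) (ℤP.*-identityˡ _) lt)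

≈-∣∣<1/25⇒ : ∀ {r p q} .{{_ : ℤ.NonZero q}} → r ≈ p ÷ q → ℚ.∣ r ∣ ℚ.< + 1 ℚ./ 25 →
             ℤ.∣ p ∣ ℕ.* 25 ℕ.< ℤ.∣ q ∣
≈-∣∣<1/25⇒ {r} {p} {q} (mk≈ r≈p/q) ∣r∣<1/25 = ℕP.*-cancelʳ-< (ℤ.∣ ↧ r ∣) _ _
  (subst₂ ℕ._<_ (swap (ℤ.∣ ↥ r ∣) (ℤ.∣ q ∣) (ℤ.∣ p ∣) (ℤ.∣ ↧ r ∣) ∣cross∣)
                (ℕP.*-comm (ℤ.∣ ↧ r ∣) (ℤ.∣ q ∣))
          (ℕP.*-monoˡ-< (ℤ.∣ q ∣) (∣∣<1/25⇒ r ∣r∣<1/25)))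
  where
  ∣cross∣ : ℤ.∣ ↥ r ∣ ℕ.* ℤ.∣ q ∣ ≡ ℤ.∣ p ∣ ℕ.* ℤ.∣ ↧ r ∣
  ∣cross∣ = trans (sym (ℤP.abs-* (↥ r) q)) (trans (cong ℤ.∣_∣ r≈p/q) (ℤP.abs-* p (↧ r)))
  regroup : ∀ a b → a ℕ.* 25 ℕ.* b ≡ 25 ℕ.* (a ℕ.* b)
  regroup = ℕ-Solver.solve-∀
  swap : ∀ a b c d → a ℕ.* b ≡ c ℕ.* d → a ℕ.* 25 ℕ.* b ≡ c ℕ.* 25 ℕ.* d
  swap a b c d ab≡cd = begin
    a ℕ.* 25 ℕ.* b     ≡⟨ regroup a b ⟩
    25 ℕ.* (a ℕ.* b)   ≡⟨ cong (25 ℕ.*_) ab≡cd ⟩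
    25 ℕ.* (c ℕ.* d)   ≡⟨ regroup c d ⟨
    c ℕ.* 25 ℕ.* d     ∎

/-<-half⇔ : ∀ i d .{{_ : ℕ.NonZero d}} → (+ i ℚ./ d ℚ.< half) ⇔ (i ℕ.* 2 ℕ.< d)
/-<-half⇔ i (suc d) = mk⇔ to from
  where
  r = + i ℚ./ suc d
  r≃ : ℚ.toℚᵘ r ℚᵘ.≃ ℚᵘ.mkℚᵘ (+ i) d
  r≃ = ℚP.toℚᵘ-fromℚᵘ (ℚᵘ.mkℚᵘ (+ i) d)
  to : r ℚ.< half → i ℕ.* 2 ℕ.< suc d
  to r<½ with ℚᵘP.<-respˡ-≃ r≃ (ℚP.toℚᵘ-mono-< r<½)
  ... | ℚᵘ.*<* lt = ℤP.drop‿+<+ (subst₂ ℤ._<_ (sym (ℤP.pos-* i 2)) (ℤP.*-identityˡ _) lt)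
  from : i ℕ.* 2 ℕ.< suc d → r ℚ.< half
  from lt = ℚP.toℚᵘ-cancel-< (ℚᵘP.<-respˡ-≃ (ℚᵘP.≃-sym r≃)
    (ℚᵘ.*<* (subst₂ ℤ._<_ (ℤP.pos-* i 2) (sym (ℤP.*-identityˡ _)) (ℤ.+<+ lt))))

-- Ratios of consecutive terms of a recurrence

casoratian : (ℕ → ℤ) → ℕ → ℕ → ℤ
casoratian a p k = a (k ℕ.+ p) ℤ.* a (suc k) ℤ.- a k ℤ.* a (suc k ℕ.+ p)

casoratian-suc : ∀ {t d a} → LinRec t d a → ∀ p k → casoratian a p (suc k) ≡ d ℤ.* casoratian a p k
casoratian-suc {t} {d} {a} rec p k = begin
  a (1 ℕ.+ k ℕ.+ p) ℤ.* a (2 ℕ.+ k) ℤ.- a (1 ℕ.+ k) ℤ.* a (2 ℕ.+ k ℕ.+ p)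
    ≡⟨ cong₂ (λ u v → a (1 ℕ.+ k ℕ.+ p) ℤ.* u ℤ.- a (1 ℕ.+ k) ℤ.* v)
             (step rec k) (step rec (k ℕ.+ p)) ⟩
  a (1 ℕ.+ k ℕ.+ p) ℤ.* (t ℤ.* a (1 ℕ.+ k) ℤ.- d ℤ.* a k)
    ℤ.- a (1 ℕ.+ k) ℤ.* (t ℤ.* a (1 ℕ.+ k ℕ.+ p) ℤ.- d ℤ.* a (k ℕ.+ p))
    ≡⟨ expand t d (a k) (a (1 ℕ.+ k)) (a (k ℕ.+ p)) (a (1 ℕ.+ k ℕ.+ p)) ⟩
  d ℤ.* casoratian a p k ∎
  where
  expand : ∀ t d x₀ x₁ y₀ y₁ → y₁ ℤ.* (t ℤ.* x₁ ℤ.- d ℤ.* x₀) ℤ.- x₁ ℤ.* (t ℤ.* y₁ ℤ.- d ℤ.* y₀)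
                             ≡ d ℤ.* (y₀ ℤ.* x₁ ℤ.- x₀ ℤ.* y₁)
  expand = solve-∀

casoratian-vanishes : ∀ {t d a} .{{_ : ℤ.NonZero d}} → LinRec t d a →
                      ∀ p k → casoratian a p k ≡ + 0 → casoratian a p 0 ≡ + 0
casoratian-vanishes rec p zero    C≡0 = C≡0
casoratian-vanishes {d = d} rec p (suc k) C≡0 = casoratian-vanishes rec p k
  (ℤP.*-cancelˡ-≡ d _ (+ 0) (trans (sym (casoratian-suc rec p k)) (trans C≡0 (sym (ℤP.*-zeroʳ d)))))

square-nonNeg : ∀ i → + 0 ℤ.≤ i ℤ.* i
square-nonNeg (+ n)     = subst (+ 0 ℤ.≤_) (sym (ℤP.+◃n≡+n (n ℕ.* n))) (ℤ.+≤+ z≤n)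
square-nonNeg -[1+ n ]  = ℤ.+≤+ z≤n

sumOfSquares-nonNeg : ∀ k m s t w → + suc k ℤ.* w ≡ s ℤ.* s ℤ.+ + m ℤ.* (t ℤ.* t) → + 0 ℤ.≤ w
sumOfSquares-nonNeg k m s t w eq = ℤP.*-cancelˡ-≤-pos (+ 0) w (+ suc k)
  (subst₂ ℤ._≤_ (sym (ℤP.*-zeroʳ (+ suc k))) (sym eq)
    (ℤP.+-mono-≤ (square-nonNeg s)
      (subst (ℤ._≤ + m ℤ.* (t ℤ.* t)) (ℤP.*-zeroʳ (+ m))
        (ℤP.*-monoˡ-≤-nonNeg (+ m) (square-nonNeg t)))))

∣i∣≤∣j∣ : ∀ {i j} → i ℤ.≤ j → ℤ.- i ℤ.≤ j → ℤ.∣ i ∣ ℕ.≤ ℤ.∣ j ∣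
∣i∣≤∣j∣ {+ _}      {+ _}      (ℤ.+≤+ i≤j) _            = i≤j
∣i∣≤∣j∣ { -[1+ _ ]} {+ _}      _           (ℤ.+≤+ -i≤j) = -i≤j
∣i∣≤∣j∣ { -[1+ _ ]} { -[1+ _ ]} _          ()

-- The form b² − 8ab + 25a² = (b − 4a)² + 9a² is positive definite; the two
-- certificates below bound 25 (b² − ac) ± bc from below by sums of squares.
quadratic-bound : ∀ a b → let c = + 8 ℤ.* b ℤ.- + 25 ℤ.* a in
                  ℤ.∣ c ℤ.* b ∣ ℕ.≤ ℤ.∣ b ℤ.* b ℤ.- a ℤ.* c ∣ ℕ.* 25
quadratic-bound a b =
  subst (ℤ.∣ u ∣ ℕ.≤_) (ℤP.abs-* (b ℤ.* b ℤ.- a ℤ.* c) (+ 25)) (∣i∣≤∣j∣ u≤v -u≤v)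
  where
  c = + 8 ℤ.* b ℤ.- + 25 ℤ.* a
  u = c ℤ.* b
  v = (b ℤ.* b ℤ.- a ℤ.* c) ℤ.* + 25
  upper-certificate : ∀ a b → let c = + 8 ℤ.* b ℤ.- + 25 ℤ.* a in
          + 68 ℤ.* ((b ℤ.* b ℤ.- a ℤ.* c) ℤ.* + 25 ℤ.- c ℤ.* b)
            ≡ (+ 34 ℤ.* b ℤ.- + 175 ℤ.* a) ℤ.* (+ 34 ℤ.* b ℤ.- + 175 ℤ.* a)
              ℤ.+ + 11875 ℤ.* (a ℤ.* a)
  upper-certificate = solve-∀
  lower-certificate : ∀ a b → let c = + 8 ℤ.* b ℤ.- + 25 ℤ.* a in
          + 132 ℤ.* ((b ℤ.* b ℤ.- a ℤ.* c) ℤ.* + 25 ℤ.+ c ℤ.* b)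
            ≡ (+ 66 ℤ.* b ℤ.- + 225 ℤ.* a) ℤ.* (+ 66 ℤ.* b ℤ.- + 225 ℤ.* a)
              ℤ.+ + 31875 ℤ.* (a ℤ.* a)
  lower-certificate = solve-∀
  u≤v : u ℤ.≤ v
  u≤v = ℤP.0≤i-j⇒j≤i
    (sumOfSquares-nonNeg 67 11875 (+ 34 ℤ.* b ℤ.- + 175 ℤ.* a) a (v ℤ.- u) (upper-certificate a b))
  -u≤v : ℤ.- u ℤ.≤ v
  -u≤v = ℤP.0≤i-j⇒j≤i (subst (+ 0 ℤ.≤_) (cong (ℤ._+_ v) (sym (ℤP.neg-involutive u)))
    (sumOfSquares-nonNeg 131 31875 (+ 66 ℤ.* b ℤ.- + 225 ℤ.* a) a (v ℤ.+ u)
      (lower-certificate a b)))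

module RatioOfConsecutiveTerms {a : ℕ → ℤ} (rec : LinRec (+ 8) (+ 25) a)
                               (5∤a₀ : ¬ + 5 ∣ a 0) (5∤a₁ : ¬ + 5 ∣ a 1) where

  5∣a[2+n]⇒5∣a[1+n] : ∀ n → + 5 ∣ a (2 ℕ.+ n) → + 5 ∣ a (1 ℕ.+ n)
  5∣a[2+n]⇒5∣a[1+n] n 5∣a₂ =
    subst (+ 5 ∣_) (sym a₁≡)
      (∣m∣n⇒∣m+n (∣n⇒∣m*n (+ 2) 5∣a₂) (∣n⇒∣m*n (+ 10 ℤ.* a₀ ℤ.- + 3 ℤ.* a₁) ∣-refl))
    where
    a₀ = a n
    a₁ = a (1 ℕ.+ n)
    eliminate : ∀ x₀ x₁ →
                x₁ ≡ + 2 ℤ.* (+ 8 ℤ.* x₁ ℤ.- + 25 ℤ.* x₀) ℤ.+ (+ 10 ℤ.* x₀ ℤ.- + 3 ℤ.* x₁) ℤ.* + 5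
    eliminate = solve-∀
    a₁≡ : a₁ ≡ + 2 ℤ.* a (2 ℕ.+ n) ℤ.+ (+ 10 ℤ.* a₀ ℤ.- + 3 ℤ.* a₁) ℤ.* + 5
    a₁≡ = trans (eliminate a₀ a₁)
      (cong (λ x → + 2 ℤ.* x ℤ.+ (+ 10 ℤ.* a₀ ℤ.- + 3 ℤ.* a₁) ℤ.* + 5) (sym (step rec n)))

  5∤a : ∀ n → ¬ + 5 ∣ a n
  5∤a zero          = 5∤a₀
  5∤a (suc zero)    = 5∤a₁
  5∤a (suc (suc n)) = 5∤a (suc n) ∘ 5∣a[2+n]⇒5∣a[1+n] n

  a≢0 : ∀ n → ℤ.NonZero (a n)
  a≢0 n = ℤ.≢-nonZero λ a[n]≡0 → 5∤a n (subst (+ 5 ∣_) (sym a[n]≡0) (divides (+ 0) refl))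

  a[1+n]≢a[2+n] : ∀ n → a (1 ℕ.+ n) ≢ a (2 ℕ.+ n)
  a[1+n]≢a[2+n] n a₁≡a₂ = 5∤a (1 ℕ.+ n) (subst (+ 5 ∣_) (sym a₁≡)
    (∣m∣n⇒∣m+n (∣n⇒∣m*n (+ 3) (subst (+ 5 ∣_) (sym a₂-a₁≡0) (divides (+ 0) refl)))
               (∣n⇒∣m*n (+ 15 ℤ.* a₀ ℤ.- + 4 ℤ.* a₁) ∣-refl)))
    where
    a₀ = a n
    a₁ = a (1 ℕ.+ n)
    a₂ = a (2 ℕ.+ n)
    eliminate : ∀ x₀ x₁ →
                x₁ ≡ + 3 ℤ.* ((+ 8 ℤ.* x₁ ℤ.- + 25 ℤ.* x₀) ℤ.- x₁)
                     ℤ.+ (+ 15 ℤ.* x₀ ℤ.- + 4 ℤ.* x₁) ℤ.* + 5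
    eliminate = solve-∀
    a₁≡ : a₁ ≡ + 3 ℤ.* (a₂ ℤ.- a₁) ℤ.+ (+ 15 ℤ.* a₀ ℤ.- + 4 ℤ.* a₁) ℤ.* + 5
    a₁≡ = trans (eliminate a₀ a₁)
      (cong (λ x → + 3 ℤ.* (x ℤ.- a₁) ℤ.+ (+ 15 ℤ.* a₀ ℤ.- + 4 ℤ.* a₁) ℤ.* + 5) (sym (step rec n)))
    a₂-a₁≡0 : a₂ ℤ.- a₁ ≡ + 0
    a₂-a₁≡0 = ℤP.i≡j⇒i-j≡0 (sym a₁≡a₂)

  ratio : ℕ → ℚ
  ratio n = a n ÷ℤ a (suc n)

  ratio-≈ : ∀ n → ratio n ≈ a n ÷ a (suc n)
  ratio-≈ n = ÷ℤ-≈ (a n) (a (suc n)) {{a≢0 (suc n)}}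

  ratio-gap : ∀ n → ¬ ℚ.∣ ratio (suc n) ℚ.- ratio n ∣ ℚ.< + 1 ℚ./ 25
  ratio-gap n gap = ℕP.<⇒≱ (≈-∣∣<1/25⇒ {{a₂a₁≢0}} (-‿≈ (ratio-≈ (suc n)) (ratio-≈ n)) gap) bound
    where
    a₀ = a n
    a₁ = a (1 ℕ.+ n)
    a₂ = a (2 ℕ.+ n)
    a₂a₁≢0 : ℤ.NonZero (a₂ ℤ.* a₁)
    a₂a₁≢0 = ℤP.i*j≢0 a₂ a₁ {{a≢0 (2 ℕ.+ n)}} {{a≢0 (1 ℕ.+ n)}}
    bound : ℤ.∣ a₂ ℤ.* a₁ ∣ ℕ.≤ ℤ.∣ a₁ ℤ.* a₁ ℤ.- a₀ ℤ.* a₂ ∣ ℕ.* 25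
    bound = subst (λ c → ℤ.∣ c ℤ.* a₁ ∣ ℕ.≤ ℤ.∣ a₁ ℤ.* a₁ ℤ.- a₀ ℤ.* c ∣ ℕ.* 25) (sym (step rec n))
                  (quadratic-bound a₀ a₁)

  ratio-aperiodic : a 0 ≡ a 1 → ∀ n p → ratio (n ℕ.+ suc p) ≢ ratio n
  ratio-aperiodic a₀≡a₁ n p ratio≡ = a[1+n]≢a[2+n] p a[1+p]≡a[2+p]
    where
    a-cross : a (n ℕ.+ suc p) ℤ.* a (suc n) ≡ a n ℤ.* a (suc (n ℕ.+ suc p))
    a-cross = ≈-unique (ratio-≈ (n ℕ.+ suc p))
                       (subst (λ r → r ≈ a n ÷ a (suc n)) (sym ratio≡) (ratio-≈ n))
    C₀≡0 : casoratian a (suc p) 0 ≡ + 0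
    C₀≡0 = casoratian-vanishes rec (suc p) n (ℤP.i≡j⇒i-j≡0 a-cross)
    a[1+p]≡a[2+p] : a (1 ℕ.+ p) ≡ a (2 ℕ.+ p)
    a[1+p]≡a[2+p] = ℤP.*-cancelˡ-≡ (a 0) _ _ {{a≢0 0}} (begin
      a 0 ℤ.* a (1 ℕ.+ p)   ≡⟨ ℤP.*-comm (a 0) _ ⟩
      a (1 ℕ.+ p) ℤ.* a 0   ≡⟨ cong (ℤ._*_ (a (1 ℕ.+ p))) a₀≡a₁ ⟩
      a (1 ℕ.+ p) ℤ.* a 1   ≡⟨ ℤP.i-j≡0⇒i≡j _ _ C₀≡0 ⟩
      a 0 ℤ.* a (2 ℕ.+ p)   ∎)

-- The block masses Σ_D(n)

powerEntry : ℕ → ℤ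
powerEntry k = a11 (B₁ ^ᴹ k)

D-2^n+ : ∀ n i → i ℕ.< 2 ^ n → D (2 ^ n ℕ.+ i) ≡ powerEntry (1 ℕ.+ s₂ i)
D-2^n+ n i i<2^n = cong powerEntry (s₂-2^n+ n i i<2^n)

sum-D-2^n+ : ∀ n k → k ℕ.≤ 2 ^ n →
             sumFrom 0 k (λ i → D (2 ^ n ℕ.+ i)) ≡ sumFrom 0 k (λ i → powerEntry (1 ℕ.+ s₂ i))
sum-D-2^n+ n k k≤2^n = sumFrom-cong 0 k λ i _ i<k → D-2^n+ n i (ℕP.<-≤-trans i<k k≤2^n)

Σ-D≡binarySum : ∀ n → Σ-D n ≡ binarySum powerEntry n 1
Σ-D≡binarySum n = trans (sumFrom-from-0 (2 ^ n) (2 ^ n) D) (sum-D-2^n+ n (2 ^ n) ℕP.≤-refl)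

Σ-D-linRec : LinRec (+ 8) (+ 25) Σ-D
Σ-D-linRec = linRec-resp (λ n → sym (Σ-D≡binarySum n)) (binarySum-linRec (a11-^ᴹ-linRec B₁) 1)

atom-2^n+ : ∀ n i → atom n (2 ^ n ℕ.+ i) ≡ (+ i ℚ./ 2 ^ n) {{ℕP.m^n≢0 2 n}}
atom-2^n+ n i = cong (λ k → (+ k ℚ./ 2 ^ n) {{ℕP.m^n≢0 2 n}}) (ℕP.m+n∸m≡n (2 ^ n) i)

weightHalf-lower : ∀ n i → i ℕ.* 2 ℕ.< 2 ^ n → weightHalf n (2 ^ n ℕ.+ i) ≡ D (2 ^ n ℕ.+ i)
weightHalf-lower n i i*2<2^n with atom n (2 ^ n ℕ.+ i) <? half
... | yes _   = refl
... | no  ≮½ = ⊥-elim (≮½ (subst (ℚ._< half) (sym (atom-2^n+ n i))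
                 (Equivalence.from (/-<-half⇔ i (2 ^ n) {{ℕP.m^n≢0 2 n}}) i*2<2^n)))

weightHalf-upper : ∀ n i → 2 ^ n ℕ.≤ i ℕ.* 2 → weightHalf n (2 ^ n ℕ.+ i) ≡ + 0
weightHalf-upper n i 2^n≤i*2 with atom n (2 ^ n ℕ.+ i) <? half
... | no  _  = refl
... | yes <½ = ⊥-elim (ℕP.≤⇒≯ 2^n≤i*2 (Equivalence.to (/-<-half⇔ i (2 ^ n) {{ℕP.m^n≢0 2 n}})
                 (subst (ℚ._< half) (atom-2^n+ n i) <½)))

lowerHalfSum : ∀ n → sumFrom (2 ^ suc n) (2 ^ suc n) (weightHalf (suc n)) ≡ Σ-D n
lowerHalfSum n = begin
  sumFrom N₂ N₂ (weightHalf (suc n))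
    ≡⟨ sumFrom-from-0 N₂ N₂ (weightHalf (suc n)) ⟩
  sumFrom 0 (N ℕ.+ (N ℕ.+ 0)) w
    ≡⟨ cong (λ k → sumFrom 0 (N ℕ.+ k) w) (ℕP.+-identityʳ N) ⟩
  sumFrom 0 (N ℕ.+ N) w
    ≡⟨ sumFrom-split 0 N N w ⟩
  sumFrom 0 N w ℤ.+ sumFrom N N w
    ≡⟨ cong₂ ℤ._+_ (sumFrom-cong 0 N lower) (trans (sumFrom-cong N N upper) (sumFrom-0 N N)) ⟩
  sumFrom 0 N (λ i → D (N₂ ℕ.+ i)) ℤ.+ + 0
    ≡⟨ ℤP.+-identityʳ _ ⟩
  sumFrom 0 N (λ i → D (N₂ ℕ.+ i))
    ≡⟨ sum-D-2^n+ (suc n) N (ℕP.m≤m+n N (N ℕ.+ 0)) ⟩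
  binarySum powerEntry n 1
    ≡⟨ Σ-D≡binarySum n ⟨
  Σ-D n ∎
  where
  N = 2 ^ n
  N₂ = 2 ^ suc n
  w = λ i → weightHalf (suc n) (N₂ ℕ.+ i)
  i*2<N₂ : ∀ {i} → i ℕ.< N → i ℕ.* 2 ℕ.< N₂
  i*2<N₂ {i} i<N = subst (i ℕ.* 2 ℕ.<_) (ℕP.*-comm N 2) (ℕP.*-monoˡ-< 2 i<N)
  lower : ∀ i → 0 ℕ.≤ i → i ℕ.< N → w i ≡ D (N₂ ℕ.+ i)
  lower i _ i<N = weightHalf-lower (suc n) i (i*2<N₂ i<N)
  upper : ∀ i → N ℕ.≤ i → i ℕ.< N ℕ.+ N → w i ≡ + 0
  upper i N≤i _ =
    weightHalf-upper (suc n) i (subst (ℕ._≤ i ℕ.* 2) (ℕP.*-comm N 2) (ℕP.*-monoˡ-≤ 2 N≤i))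

μ-half-suc : ∀ n → μ-half (suc n) ≡ Σ-D n ÷ℤ Σ-D (suc n)
μ-half-suc n = cong (_÷ℤ Σ-D (suc n)) (lowerHalfSum n)

5∤3 : ¬ + 5 ∣ + 3
5∤3 = from-no (+ 5 ∣? + 3)

-- Σ-D 0 = D 1 = 3 and Σ-D 1 = D 2 + D 3 = 3 + 0 hold by evaluation.
open RatioOfConsecutiveTerms Σ-D-linRec 5∤3 5∤3

proposition5p1 : ¬ Converges μ-half × ¬ EventuallyPeriodic μ-half
proposition5p1 = not-converges , not-eventually-periodic
  where
  not-converges : ¬ Converges μ-half
  not-converges cauchy with cauchy (+ 1 ℚ./ 25) (ℚ.*<* (ℤ.+<+ (s≤s z≤n)))
  ... | N , close = ratio-gap N
    (subst₂ (λ x y → ℚ.∣ x ℚ.- y ∣ ℚ.< + 1 ℚ./ 25) (μ-half-suc (suc N)) (μ-half-suc N)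
            (close (2 ℕ.+ N) (1 ℕ.+ N) (ℕP.m≤n+m N 2) (ℕP.m≤n+m N 1)))
  not-eventually-periodic : ¬ EventuallyPeriodic μ-half
  not-eventually-periodic (N , suc p , _ , periodic) =
    ratio-aperiodic refl N p
      (subst₂ _≡_ (μ-half-suc (N ℕ.+ suc p)) (μ-half-suc N) (periodic (suc N) (ℕP.n≤1+n N)))
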